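{- Let $f_1,f_2,f_3:\{0,1\}^n\times\{0,1\}^n\to\{0,1\}$ be two-argument functions (for each $n$) whose non-deterministic communication complexity $N^1$ is $\Omega(n)$. For $x=x_1\circ x_2$, $y=y_1\circ y_2$, $z=z_1\circ z_2$ with $x_1,x_2,y_1,y_2,z_1,z_2\in\{0,1\}^n$, define the relation $R\subseteq\{0,1\}^{2n}\times\{0,1\}^{2n}\times\{0,1\}^{2n}\times([3]\times\{0,1\})$ by: $(x,y,z,(i,b))\in R$ iff (i) $i=1$ and $f_1(x_1,y_1)=b$, or (ii) $i=2$ and $f_2(x_2,z_1)=b$, or (iii) $i=3$ and $f_3(y_2,z_2)=b$. Then the deterministic $3$-party communication complexity of $R$ is $\Omega(n)$.
   Context: $\circ$ denotes string concatenation. For a two-argument function $g$, a $1$-monochromatic rectangle is a set $X\times Y$ on which $g\equiv1$, $C^1(g)$ is the minimum number of (possibly overlapping) $1$-monochromatic rectangles whose union is $g^{ -1}(1)$, and $N^1(g)=\log_2C^1(g)$. In the $3$-party "number in hand" model for the relation $R$, players holding $x$, $y$, $z$ respectively communicate over a broadcast channel and must output some $o\in[3]\times\{0,1\}$ with $(x,y,z,o)\in R$; the deterministic communication complexity of $R$ is the worst-case number of bits sent by the best deterministic protocol doing so. -}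

module Defs where

open import Data.Nat using (ℕ; zero; suc; _+_; _*_; _^_; _≤_; _⊔_)
open import Data.Bool using (Bool; true; false; if_then_else_)
open import Data.Fin using (Fin; zero; suc)
open import Data.Vec using (Vec; take; drop)
open import Data.Product using (_×_; _,_; Σ; ∃; ∃-syntax)
open import Relation.Binary.PropositionalEquality using (_≡_)

Bits : ℕ → Set
Bits n = Vec Bool n

record Rect (n : ℕ) : Set where
  constructor rect
  field
    rowSet : Bits n → Bool
    colSet : Bits n → Bool
open Rect public

OneMono : ∀ {n} → (Bits n → Bits n → Bool) → Rect n → Set
OneMono g r = ∀ x y → rowSet r x ≡ true → colSet r y ≡ true → g x y ≡ true

OneCover : ∀ {n} → (Bits n → Bits n → Bool) → ℕ → Set
OneCover {n} g k =
  Σ (Fin k → Rect n) λ rs →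
    (∀ i → OneMono g (rs i)) ×
    (∀ x y → g x y ≡ true →
       ∃[ i ] (rowSet (rs i) x ≡ true × colSet (rs i) y ≡ true))

IsC1 : ∀ {n} → (Bits n → Bits n → Bool) → ℕ → Set
IsC1 g k = OneCover g k × (∀ k' → OneCover g k' → k ≤ k')

-- N^1(f_n) = log₂ C^1(f_n) = Ω(n):
-- ∃ constant c = 1/d > 0 and n₀ with log₂ C^1(f_n) ≥ n/d for n ≥ n₀,
-- i.e. 2^n ≤ C^1(f_n)^d.
N1Omega : ((n : ℕ) → Bits n → Bits n → Bool) → Set
N1Omega f =
  ∃[ d ] ∃[ n₀ ] (1 ≤ d ×
    (∀ n → n₀ ≤ n → ∀ k → IsC1 (f n) k → 2 ^ n ≤ k ^ d))

-- protocol tree: at each internal node one player broadcasts a bit that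
-- depends on its own input (and, via the position in the tree, on the
-- transcript so far); leaves carry the output.
data Protocol (A B C O : Set) : Set where
  leaf  : O → Protocol A B C O
  node₁ : (A → Bool) → Protocol A B C O → Protocol A B C O → Protocol A B C O
  node₂ : (B → Bool) → Protocol A B C O → Protocol A B C O → Protocol A B C O
  node₃ : (C → Bool) → Protocol A B C O → Protocol A B C O → Protocol A B C O

run : ∀ {A B C O} → Protocol A B C O → A → B → C → O
run (leaf o)        a b c = o
run (node₁ s p q)   a b c = if s a then run q a b c else run p a b c
run (node₂ s p q)   a b c = if s b then run q a b c else run p a b c
run (node₃ s p q)   a b c = if s c then run q a b c else run p a b c

cost : ∀ {A B C O} → Protocol A B C O → ℕ
cost (leaf o)      = 0
cost (node₁ _ p q) = suc (cost p ⊔ cost q)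
cost (node₂ _ p q) = suc (cost p ⊔ cost q)
cost (node₃ _ p q) = suc (cost p ⊔ cost q)

Computes : ∀ {A B C O} → (A → B → C → O → Set) → Protocol A B C O → Set
Computes R P = ∀ a b c → R a b c (run P a b c)

IsDCC : ∀ {A B C O} → (A → B → C → O → Set) → ℕ → Set
IsDCC {A} {B} {C} {O} R m =
  (Σ (Protocol A B C O) λ P → Computes R P × cost P ≡ m) ×
  (∀ (P : Protocol A B C O) → Computes R P → m ≤ cost P)

Out : Set
Out = Fin 3 × Bool

-- x = x₁ ∘ x₂ with x₁ = take n x, x₂ = drop n x
RelR : (f₁ f₂ f₃ : (n : ℕ) → Bits n → Bits n → Bool) →
       (n : ℕ) → Bits (n + n) → Bits (n + n) → Bits (n + n) → Out → Set
RelR f₁ f₂ f₃ n x y z (zero , b)             = f₁ n (take n x) (take n y) ≡ b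
RelR f₁ f₂ f₃ n x y z (suc zero , b)         = f₂ n (drop n x) (take n z) ≡ b
RelR f₁ f₂ f₃ n x y z (suc (suc zero) , b)   = f₃ n (drop n y) (drop n z) ≡ b

-- Lemma 6: a deterministic 3-party protocol for the relation R must send
-- Ω(n) bits, because a protocol of cost m yields a 1-cover of size 2^m of
-- one of f₁, f₂, f₃.
--
-- The inputs consistent with a path t of m broadcasts form a rectangle
-- X t × Y t × Z t on which the protocol answers with the output at t.
-- From these rectangles we build 2^m rectangles for f₁.  If they do not
-- cover f₁⁻¹(1), some 1-input (a₁, b₁) is missed; fixing x₁ = a₁, y₁ = b₁
-- we build 2^m rectangles for f₂.  If they also miss some 1-input
-- (a₂, c₁), then on inputs x = a₁∘a₂, y = b₁∘y₂, z = c₁∘z₂ the protocol can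
-- answer neither for f₁ nor for f₂, so the 2^m rectangles built with x,
-- y₁ = b₁ and z₁ = c₁ fixed cover f₃⁻¹(1).  Whichever f_i is covered
-- satisfies C¹(f_i) ≤ 2^m, and 2^n ≤ C¹(f_i)^d then gives n ≤ d·m.
module Submission where

open import Defs
open import Data.Bool using (Bool; true; false; if_then_else_)
import Data.Bool.Properties as Bool
open import Data.Empty using (⊥-elim)
open import Data.Fin using (Fin; zero; suc; finToFun; funToFin)
open import Data.Fin.Properties as Fin using (2↔Bool; finToFun-funToFin)
open import Data.Fin.Subset.Properties using (anySubset?)
open import Data.Nat using (ℕ; zero; suc; _+_; _*_; _^_; _≤_; _<_; _⊔_; z≤n; s≤s; s≤s⁻¹; _≤?_)
open import Data.Nat.Induction using (<-rec)
open import Data.Nat.Properties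
open import Data.Product using (Σ; ∃; ∃-syntax; _×_; _,_)
open import Data.Product.Properties using (≡-dec)
open import Data.Sum using (_⊎_; inj₁; inj₂)
open import Data.Unit using (⊤; tt)
open import Data.Vec using (Vec; []; _∷_; _++_; take; drop; tabulate; lookup)
open import Data.Vec.Properties using (take++drop≡id; ++-injectiveˡ; ++-injectiveʳ; tabulate-cong; tabulate∘lookup)
open import Function using (_∘_)
open import Function.Bundles using (Inverse)
open import Level using (0ℓ)
open import Relation.Nullary using (¬_; Dec; yes; no; does)
open import Relation.Nullary.Decidable using (dec-true; decidable-stable; ¬?; _×-dec_)
open import Relation.Unary using (Pred; Decidable)
open import Relation.Binary.PropositionalEquality

take-++ : ∀ {A : Set} {m k} (xs : Vec A m) (ys : Vec A k) → take m (xs ++ ys) ≡ xs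
take-++ {m = m} xs ys = ++-injectiveˡ _ xs (take++drop≡id m (xs ++ ys))

drop-++ : ∀ {A : Set} {m k} (xs : Vec A m) (ys : Vec A k) → drop m (xs ++ ys) ≡ ys
drop-++ {m = m} xs ys = ++-injectiveʳ _ xs (take++drop≡id m (xs ++ ys))

bits : ∀ {m} → Fin (2 ^ m) → Bits m
bits i = tabulate (Inverse.to 2↔Bool ∘ finToFun i)

bits-surjective : ∀ {m} (t : Bits m) → ∃[ i ] bits i ≡ t
bits-surjective t = funToFin (from ∘ lookup t) , (begin
    tabulate (to ∘ finToFun (funToFin (from ∘ lookup t)))
  ≡⟨ tabulate-cong (λ j → trans (cong to (finToFun-funToFin (from ∘ lookup t) j))
                                (strictlyInverseˡ (lookup t j))) ⟩
    tabulate (lookup t)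
  ≡⟨ tabulate∘lookup t ⟩
    t
  ∎)
  where open Inverse 2↔Bool
        open ≡-Reasoning

dec-sound : ∀ {P : Set} (p? : Dec P) → does p? ≡ true → P
dec-sound (yes p) _ = p
dec-sound (no _) ()

infix 4 _∈_
_∈_ : ∀ {n} → Bits n × Bits n → Rect n → Set
(x , y) ∈ r = rowSet r x ≡ true × colSet r y ≡ true

-- A 1-cover of g by rectangles indexed by an arbitrary type I;
-- OneCover g k is, by definition, Cover g (Fin k).
Cover : ∀ {n} → (Bits n → Bits n → Bool) → Set → Set
Cover {n} g I =
  Σ (I → Rect n) λ rs → (∀ i → OneMono g (rs i)) ×
                        (∀ x y → g x y ≡ true → ∃[ i ] (x , y) ∈ rs i)

reindex : ∀ {n} {g : Bits n → Bits n → Bool} {I J : Set} (s : J → I) →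
          (∀ i → ∃[ j ] s j ≡ i) → Cover g I → Cover g J
reindex {g = g} s surj (rs , mono , covers) = rs ∘ s , mono ∘ s , covered
  where
  covered : ∀ x y → g x y ≡ true → ∃[ j ] (x , y) ∈ rs (s j)
  covered x y gxy with covers x y gxy
  ... | i , xy∈ with surj i
  ...   | j , refl = j , xy∈

_⊠_ : ∀ {n} {X Y : Pred (Bits n) 0ℓ} → Decidable X → Decidable Y → Rect n
X? ⊠ Y? = rect (does ∘ X?) (does ∘ Y?)

⊠-∈ : ∀ {n} {X Y : Pred (Bits n) 0ℓ} (X? : Decidable X) (Y? : Decidable Y) {x y} →
      X x → Y y → (x , y) ∈ (X? ⊠ Y?)
⊠-∈ X? Y? {x} {y} x∈ y∈ = dec-true (X? x) x∈ , dec-true (Y? y) y∈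

⊠-mono : ∀ {n} {X Y : Pred (Bits n) 0ℓ} (X? : Decidable X) (Y? : Decidable Y)
         {g : Bits n → Bits n → Bool} →
         (∀ x y → X x → Y y → g x y ≡ true) → OneMono g (X? ⊠ Y?)
⊠-mono X? Y? one x y x∈ y∈ = one x y (dec-sound (X? x) x∈) (dec-sound (Y? y) y∈)

covered? : ∀ {n m} (rs : Bits m → Rect n) x y → Dec (∃[ t ] (x , y) ∈ rs t)
covered? rs x y = anySubset? λ t → (rowSet (rs t) x Bool.≟ true) ×-dec (colSet (rs t) y Bool.≟ true)

-- By exhaustive search, a family of rectangles indexed by {0,1}^m either
-- covers g⁻¹(1) or misses an explicit 1-input of g.
covers-or-misses : ∀ {n m} (g : Bits n → Bits n → Bool) (rs : Bits m → Rect n) →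
  (∀ x y → g x y ≡ true → ∃[ t ] (x , y) ∈ rs t) ⊎
  (∃[ x ] ∃[ y ] (g x y ≡ true × ¬ (∃[ t ] (x , y) ∈ rs t)))
covers-or-misses g rs
  with anySubset? (λ x → anySubset? λ y → (g x y Bool.≟ true) ×-dec ¬? (covered? rs x y))
... | yes miss = inj₂ miss
... | no no-miss =
  inj₁ λ x y gxy → decidable-stable (covered? rs x y) λ uncovered → no-miss (x , y , gxy , uncovered)

¬¬-least : ∀ {P : Pred ℕ 0ℓ} {k} → P k → ¬ ¬ (∃[ k′ ] (P k′ × (∀ j → P j → k′ ≤ j)))
¬¬-least {P} {k} pk no-least = <-rec (λ k → ¬ P k) least-fails k pk
  where
  least-fails : ∀ k → (∀ {j} → j < k → ¬ P j) → ¬ P k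
  least-fails k below pk = no-least (k , pk , λ j pj → ≮⇒≥ λ j<k → below j<k pj)

exponent-bound : ∀ {n m d k} → 2 ^ n ≤ k ^ d → k ≤ 2 ^ m → n ≤ d * m
exponent-bound {n} {m} {d} {k} 2ⁿ≤kᵈ k≤2ᵐ = ≮⇒≥ λ dm<n →
  <⇒≱ (^-monoʳ-< 2 (s≤s (s≤s z≤n)) dm<n) (begin
    2 ^ n          ≤⟨ 2ⁿ≤kᵈ ⟩
    k ^ d          ≤⟨ ^-monoˡ-≤ d k≤2ᵐ ⟩
    (2 ^ m) ^ d    ≡⟨ ^-*-assoc 2 m d ⟩
    2 ^ (m * d)    ≡⟨ cong (2 ^_) (*-comm m d) ⟩
    2 ^ (d * m)    ∎)
  where open ≤-Reasoning

-- If 2^n ≤ C¹(g)^d, a 1-cover of g indexed by {0,1}^m forces n ≤ d · m.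
-- C¹(g) ≤ 2^m exists only up to double negation, which suffices since
-- the conclusion is decidable.
path-cover-bound : ∀ {n m d} {g : Bits n → Bits n → Bool} →
                   (∀ k → IsC1 g k → 2 ^ n ≤ k ^ d) → Cover g (Bits m) → n ≤ d * m
path-cover-bound {n} {m} {d} {g} C¹-bound cover =
  decidable-stable (n ≤? d * m) λ n≰dm →
    ¬¬-least small-cover λ (k , k-cover , k-least) →
      n≰dm (exponent-bound {n} {m} {d} (C¹-bound k (k-cover , k-least)) (k-least _ small-cover))
  where
  small-cover : OneCover g (2 ^ m)
  small-cover = reindex bits bits-surjective cover

module _ {A B C O : Set} where

  private
    Prot : Set
    Prot = Protocol A B C O

  child : Prot → Bool → Prot
  child (leaf o)      β = leaf o
  child (node₁ _ p q) β = if β then q else p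
  child (node₂ _ p q) β = if β then q else p
  child (node₃ _ p q) β = if β then q else p

  endpoint : ∀ {k} → Prot → Bits k → Prot
  endpoint P []      = P
  endpoint P (β ∷ t) = endpoint (child P β) t

  message : Prot → A → B → C → Bool
  message (leaf _)      a b c = false
  message (node₁ s _ _) a b c = s a
  message (node₂ s _ _) a b c = s b
  message (node₃ s _ _) a b c = s c

  transcript : ∀ k → Prot → A → B → C → Bits k
  transcript zero    P a b c = []
  transcript (suc k) P a b c = message P a b c ∷ transcript k (child P (message P a b c)) a b c

  run-child : ∀ P a b c → run P a b c ≡ run (child P (message P a b c)) a b c
  run-child (leaf o)      a b c = refl
  run-child (node₁ s p q) a b c = sym (Bool.if-float (λ Q → run Q a b c) (s a))
  run-child (node₂ s p q) a b c = sym (Bool.if-float (λ Q → run Q a b c) (s b))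
  run-child (node₃ s p q) a b c = sym (Bool.if-float (λ Q → run Q a b c) (s c))

  -- The output label of a protocol, meaningful once it sends no bits.
  outcome : O → Prot → O
  outcome d (leaf o) = o
  outcome d _        = d

  silent-run : ∀ d Q a b c → cost Q ≤ 0 → run Q a b c ≡ outcome d Q
  silent-run d (leaf o)      a b c _  = refl
  silent-run d (node₁ _ _ _) a b c ()
  silent-run d (node₂ _ _ _) a b c ()
  silent-run d (node₃ _ _ _) a b c ()

  -- Each broadcast lowers the cost by one, so a path as long as the cost
  -- ends in a leaf.
  branch-cost : ∀ β (p q : Prot) → cost (if β then q else p) ≤ cost p ⊔ cost q
  branch-cost true  p q = m≤n⊔m (cost p) (cost q)
  branch-cost false p q = m≤m⊔n (cost p) (cost q)

  cost-child : ∀ {k} P β → cost P ≤ suc k → cost (child P β) ≤ k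
  cost-child (leaf o)      β h = z≤n
  cost-child (node₁ _ p q) β h = ≤-trans (branch-cost β p q) (s≤s⁻¹ h)
  cost-child (node₂ _ p q) β h = ≤-trans (branch-cost β p q) (s≤s⁻¹ h)
  cost-child (node₃ _ p q) β h = ≤-trans (branch-cost β p q) (s≤s⁻¹ h)

  endpoint-silent : ∀ {k} P (t : Bits k) → cost P ≤ k → cost (endpoint P t) ≤ 0
  endpoint-silent P []      h = h
  endpoint-silent P (β ∷ t) h = endpoint-silent (child P β) t (cost-child P β h)

  Along : {X : Set} → (Prot → X → Bool → Set) → ∀ {k} → Prot → Bits k → X → Set
  Along Agrees P []      x = ⊤
  Along Agrees P (β ∷ t) x = Agrees P x β × Along Agrees (child P β) t x

  along? : {X : Set} {Agrees : Prot → X → Bool → Set} →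
           (∀ P x β → Dec (Agrees P x β)) → ∀ {k} P (t : Bits k) x → Dec (Along Agrees P t x)
  along? agrees? P []      x = yes tt
  along? agrees? P (β ∷ t) x = agrees? P x β ×-dec along? agrees? (child P β) t x

  transcript-along : {X : Set} {Agrees : Prot → X → Bool → Set} (input : A → B → C → X) →
                     (∀ P a b c → Agrees P (input a b c) (message P a b c)) →
                     ∀ k P a b c → Along Agrees P (transcript k P a b c) (input a b c)
  transcript-along input truthful zero    P a b c = tt
  transcript-along input truthful (suc k) P a b c =
    truthful P a b c , transcript-along input truthful k (child P (message P a b c)) a b c

  Agrees₁ : Prot → A → Bool → Set
  Agrees₁ (node₁ s _ _) a β = s a ≡ β
  Agrees₁ _             a β = ⊤

  Agrees₂ : Prot → B → Bool → Set
  Agrees₂ (node₂ s _ _) b β = s b ≡ β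
  Agrees₂ _             b β = ⊤

  Agrees₃ : Prot → C → Bool → Set
  Agrees₃ (node₃ s _ _) c β = s c ≡ β
  Agrees₃ _             c β = ⊤

  agrees₁? : ∀ P a β → Dec (Agrees₁ P a β)
  agrees₁? (leaf _)      a β = yes tt
  agrees₁? (node₁ s _ _) a β = s a Bool.≟ β
  agrees₁? (node₂ _ _ _) a β = yes tt
  agrees₁? (node₃ _ _ _) a β = yes tt

  agrees₂? : ∀ P b β → Dec (Agrees₂ P b β)
  agrees₂? (leaf _)      b β = yes tt
  agrees₂? (node₁ _ _ _) b β = yes tt
  agrees₂? (node₂ s _ _) b β = s b Bool.≟ β
  agrees₂? (node₃ _ _ _) b β = yes tt

  agrees₃? : ∀ P c β → Dec (Agrees₃ P c β)
  agrees₃? (leaf _)      c β = yes tt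
  agrees₃? (node₁ _ _ _) c β = yes tt
  agrees₃? (node₂ _ _ _) c β = yes tt
  agrees₃? (node₃ s _ _) c β = s c Bool.≟ β

  truthful₁ : ∀ P a b c → Agrees₁ P a (message P a b c)
  truthful₁ (leaf _)      a b c = tt
  truthful₁ (node₁ _ _ _) a b c = refl
  truthful₁ (node₂ _ _ _) a b c = tt
  truthful₁ (node₃ _ _ _) a b c = tt

  truthful₂ : ∀ P a b c → Agrees₂ P b (message P a b c)
  truthful₂ (leaf _)      a b c = tt
  truthful₂ (node₁ _ _ _) a b c = tt
  truthful₂ (node₂ _ _ _) a b c = refl
  truthful₂ (node₃ _ _ _) a b c = tt

  truthful₃ : ∀ P a b c → Agrees₃ P c (message P a b c)
  truthful₃ (leaf _)      a b c = tt
  truthful₃ (node₁ _ _ _) a b c = tt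
  truthful₃ (node₂ _ _ _) a b c = tt
  truthful₃ (node₃ _ _ _) a b c = refl

  -- Rectangle property: if each player's input agrees with the path t,
  -- running the protocol is running what is left at the end of t.
  run-endpoint : ∀ {k} P (t : Bits k) {a b c} →
                 Along Agrees₁ P t a → Along Agrees₂ P t b → Along Agrees₃ P t c →
                 run P a b c ≡ run (endpoint P t) a b c
  run-endpoint P []      _ _ _ = refl
  run-endpoint P@(leaf _) (_ ∷ t) (_ , ok₁) (_ , ok₂) (_ , ok₃) =
    run-endpoint P t ok₁ ok₂ ok₃
  run-endpoint P@(node₁ s _ _) (_ ∷ t) {a} {b} {c} (refl , ok₁) (_ , ok₂) (_ , ok₃) =
    trans (run-child P a b c) (run-endpoint (child P (s a)) t ok₁ ok₂ ok₃)
  run-endpoint P@(node₂ s _ _) (_ ∷ t) {a} {b} {c} (_ , ok₁) (refl , ok₂) (_ , ok₃) =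
    trans (run-child P a b c) (run-endpoint (child P (s b)) t ok₁ ok₂ ok₃)
  run-endpoint P@(node₃ s _ _) (_ ∷ t) {a} {b} {c} (_ , ok₁) (_ , ok₂) (refl , ok₃) =
    trans (run-child P a b c) (run-endpoint (child P (s c)) t ok₁ ok₂ ok₃)

  path-output : ∀ d P {k} (t : Bits k) {a b c} → cost P ≤ k →
                Along Agrees₁ P t a → Along Agrees₂ P t b → Along Agrees₃ P t c →
                run P a b c ≡ outcome d (endpoint P t)
  path-output d P t {a} {b} {c} h ok₁ ok₂ ok₃ =
    trans (run-endpoint P t ok₁ ok₂ ok₃) (silent-run d (endpoint P t) a b c (endpoint-silent P t h))

module ThreeCovers (f₁ f₂ f₃ : (n : ℕ) → Bits n → Bits n → Bool) (n : ℕ)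
  (P : Protocol (Bits (n + n)) (Bits (n + n)) (Bits (n + n)) Out)
  (P-computes : Computes (RelR f₁ f₂ f₃ n) P) where

  m : ℕ
  m = cost P

  Rel : Bits (n + n) → Bits (n + n) → Bits (n + n) → Out → Set
  Rel = RelR f₁ f₂ f₃ n

  X Y Z : Bits m → Pred (Bits (n + n)) 0ℓ
  X t = Along Agrees₁ P t
  Y t = Along Agrees₂ P t
  Z t = Along Agrees₃ P t

  X? : ∀ t → Decidable (X t)
  Y? : ∀ t → Decidable (Y t)
  Z? : ∀ t → Decidable (Z t)
  X? = along? agrees₁? P
  Y? = along? agrees₂? P
  Z? = along? agrees₃? P

  out : Bits m → Out
  out t = outcome (zero , false) (endpoint P t)

  Says : Fin 3 → Bits m → Set
  Says i t = out t ≡ (i , true)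

  says? : ∀ i t → Dec (Says i t)
  says? i t = ≡-dec Fin._≟_ Bool._≟_ (out t) (i , true)

  answer : ∀ t {x y z} → X t x → Y t y → Z t z → Rel x y z (out t)
  answer t {x} {y} {z} x∈ y∈ z∈ =
    subst (Rel x y z) (path-output (zero , false) P t ≤-refl x∈ y∈ z∈) (P-computes x y z)

  answer-says : ∀ i t {x y z} → Says i t → X t x → Y t y → Z t z → Rel x y z (i , true)
  answer-says i t {x} {y} {z} said x∈ y∈ z∈ = subst (Rel x y z) said (answer t x∈ y∈ z∈)

  τ : Bits (n + n) → Bits (n + n) → Bits (n + n) → Bits m
  τ = transcript m P

  τ-agrees : ∀ x y z → X (τ x y z) x × Y (τ x y z) y × Z (τ x y z) z
  τ-agrees x y z = transcript-along (λ a _ _ → a) truthful₁ m P x y z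
                 , transcript-along (λ _ b _ → b) truthful₂ m P x y z
                 , transcript-along (λ _ _ c → c) truthful₃ m P x y z

  says-one : ∀ i t {β} → out t ≡ (i , β) → β ≡ true → Says i t
  says-one i t eq refl = eq

  Row₁ Col₁ : Bits m → Pred (Bits n) 0ℓ
  Row₁ t a₁ = Says zero t × ∃ (Z t) × ∃[ x₂ ] X t (a₁ ++ x₂)
  Col₁ t b₁ = ∃[ y₂ ] Y t (b₁ ++ y₂)

  row₁? : ∀ t → Decidable (Row₁ t)
  row₁? t a₁ = says? zero t ×-dec anySubset? (Z? t) ×-dec anySubset? λ x₂ → X? t (a₁ ++ x₂)

  col₁? : ∀ t → Decidable (Col₁ t)
  col₁? t b₁ = anySubset? λ y₂ → Y? t (b₁ ++ y₂)

  R₁ : Bits m → Rect n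
  R₁ t = row₁? t ⊠ col₁? t

  R₁-mono : ∀ t → OneMono (f₁ n) (R₁ t)
  R₁-mono t = ⊠-mono (row₁? t) (col₁? t) λ { a₁ b₁ (said , (z , z∈) , (x₂ , x∈)) (y₂ , y∈) →
    subst₂ (λ u v → f₁ n u v ≡ true) (take-++ a₁ x₂) (take-++ b₁ y₂)
      (answer-says zero t said x∈ y∈ z∈) }

  module Missed₁ (a₁ b₁ : Bits n) (fa : f₁ n a₁ b₁ ≡ true)
                 (miss₁ : ¬ (∃[ t ] (a₁ , b₁) ∈ R₁ t)) where

    Row₂ Col₂ : Bits m → Pred (Bits n) 0ℓ
    Row₂ t x₂ = Says (suc zero) t × X t (a₁ ++ x₂) × ∃[ y₂ ] Y t (b₁ ++ y₂)
    Col₂ t z₁ = ∃[ z₂ ] Z t (z₁ ++ z₂)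

    row₂? : ∀ t → Decidable (Row₂ t)
    row₂? t x₂ = says? (suc zero) t ×-dec X? t (a₁ ++ x₂) ×-dec anySubset? λ y₂ → Y? t (b₁ ++ y₂)

    col₂? : ∀ t → Decidable (Col₂ t)
    col₂? t z₁ = anySubset? λ z₂ → Z? t (z₁ ++ z₂)

    R₂ : Bits m → Rect n
    R₂ t = row₂? t ⊠ col₂? t

    R₂-mono : ∀ t → OneMono (f₂ n) (R₂ t)
    R₂-mono t = ⊠-mono (row₂? t) (col₂? t) λ { x₂ z₁ (said , x∈ , (y₂ , y∈)) (z₂ , z∈) →
      subst₂ (λ u v → f₂ n u v ≡ true) (drop-++ a₁ x₂) (take-++ z₁ z₂)
        (answer-says (suc zero) t said x∈ y∈ z∈) }

    module Missed₂ (a₂ c₁ : Bits n) (fb : f₂ n a₂ c₁ ≡ true)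
                   (miss₂ : ¬ (∃[ t ] (a₂ , c₁) ∈ R₂ t)) where

      Row₃ Col₃ : Bits m → Pred (Bits n) 0ℓ
      Row₃ t y₂ = Says (suc (suc zero)) t × X t (a₁ ++ a₂) × Y t (b₁ ++ y₂)
      Col₃ t z₂ = Z t (c₁ ++ z₂)

      row₃? : ∀ t → Decidable (Row₃ t)
      row₃? t y₂ = says? (suc (suc zero)) t ×-dec X? t (a₁ ++ a₂) ×-dec Y? t (b₁ ++ y₂)

      col₃? : ∀ t → Decidable (Col₃ t)
      col₃? t z₂ = Z? t (c₁ ++ z₂)

      R₃ : Bits m → Rect n
      R₃ t = row₃? t ⊠ col₃? t

      R₃-mono : ∀ t → OneMono (f₃ n) (R₃ t)
      R₃-mono t = ⊠-mono (row₃? t) (col₃? t) λ { y₂ z₂ (said , x∈ , y∈) z∈ →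
        subst₂ (λ u v → f₃ n u v ≡ true) (drop-++ b₁ y₂) (drop-++ c₁ z₂)
          (answer-says (suc (suc zero)) t said x∈ y∈ z∈) }

      -- Every path agreeing with x = a₁∘a₂, y = b₁∘y₂, z = c₁∘z₂, where
      -- f₃(y₂, z₂) = 1, lies in R₃: an answer about f₁ or f₂ there would
      -- place (a₁, b₁) in R₁ t or (a₂, c₁) in R₂ t.
      path-in-R₃ : ∀ t {y₂ z₂} → f₃ n y₂ z₂ ≡ true →
                   X t (a₁ ++ a₂) → Y t (b₁ ++ y₂) → Z t (c₁ ++ z₂) → (y₂ , z₂) ∈ R₃ t
      path-in-R₃ t {y₂} {z₂} fc x∈ y∈ z∈ = by-output (out t) refl (answer t x∈ y∈ z∈)
        where
        by-output : ∀ o → out t ≡ o → Rel (a₁ ++ a₂) (b₁ ++ y₂) (c₁ ++ z₂) o → (y₂ , z₂) ∈ R₃ t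
        by-output (zero , β) out≡ f₁≡β =
          ⊥-elim (miss₁ (t , ⊠-∈ (row₁? t) (col₁? t) (said , (_ , z∈) , (a₂ , x∈)) (y₂ , y∈)))
          where
          said : Says zero t
          said = says-one zero t out≡
            (trans (sym f₁≡β) (trans (cong₂ (f₁ n) (take-++ a₁ a₂) (take-++ b₁ y₂)) fa))
        by-output (suc zero , β) out≡ f₂≡β =
          ⊥-elim (miss₂ (t , ⊠-∈ (row₂? t) (col₂? t) (said , x∈ , (y₂ , y∈)) (z₂ , z∈)))
          where
          said : Says (suc zero) t
          said = says-one (suc zero) t out≡
            (trans (sym f₂≡β) (trans (cong₂ (f₂ n) (drop-++ a₁ a₂) (take-++ c₁ z₂)) fb))
        by-output (suc (suc zero) , β) out≡ f₃≡β = ⊠-∈ (row₃? t) (col₃? t) (said , x∈ , y∈) z∈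
          where
          said : Says (suc (suc zero)) t
          said = says-one (suc (suc zero)) t out≡
            (trans (sym f₃≡β) (trans (cong₂ (f₃ n) (drop-++ b₁ y₂) (drop-++ c₁ z₂)) fc))

      -- Hence R₃ covers f₃⁻¹(1), using the transcript of (a₁∘a₂, b₁∘y₂, c₁∘z₂).
      R₃-covers : ∀ y₂ z₂ → f₃ n y₂ z₂ ≡ true → ∃[ t ] (y₂ , z₂) ∈ R₃ t
      R₃-covers y₂ z₂ fc =
        let t = τ (a₁ ++ a₂) (b₁ ++ y₂) (c₁ ++ z₂)
            x∈ , y∈ , z∈ = τ-agrees (a₁ ++ a₂) (b₁ ++ y₂) (c₁ ++ z₂)
        in t , path-in-R₃ t fc x∈ y∈ z∈

  open Missed₁ using (R₂; R₂-mono)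

  some-cover : Cover (f₁ n) (Bits m) ⊎ Cover (f₂ n) (Bits m) ⊎ Cover (f₃ n) (Bits m)
  some-cover with covers-or-misses (f₁ n) R₁
  ... | inj₁ covers₁ = inj₁ (R₁ , R₁-mono , covers₁)
  ... | inj₂ (a₁ , b₁ , fa , miss₁) with covers-or-misses (f₂ n) (R₂ a₁ b₁ fa miss₁)
  ...   | inj₁ covers₂ = inj₂ (inj₁ (R₂ a₁ b₁ fa miss₁ , R₂-mono a₁ b₁ fa miss₁ , covers₂))
  ...   | inj₂ (a₂ , c₁ , fb , miss₂) = inj₂ (inj₂ (R₃ , R₃-mono , R₃-covers))
    where open Missed₁.Missed₂ a₁ b₁ fa miss₁ a₂ c₁ fb miss₂

lemma6 : (f₁ f₂ f₃ : (n : ℕ) → Bits n → Bits n → Bool) →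
         N1Omega f₁ → N1Omega f₂ → N1Omega f₃ →
         ∃[ d ] ∃[ n₀ ] (1 ≤ d ×
           (∀ n → n₀ ≤ n → ∀ m → IsDCC (RelR f₁ f₂ f₃ n) m → n ≤ d * m))
lemma6 f₁ f₂ f₃ (d₁ , n₁ , 1≤d₁ , h₁) (d₂ , n₂ , _ , h₂) (d₃ , n₃ , _ , h₃) =
  d₁ + d₂ + d₃ , n₁ ⊔ n₂ ⊔ n₃ , ≤-trans 1≤d₁ d₁≤d , bound
  where
  d₁≤d : d₁ ≤ d₁ + d₂ + d₃
  d₁≤d = ≤-trans (m≤m+n d₁ d₂) (m≤m+n (d₁ + d₂) d₃)
  d₂≤d : d₂ ≤ d₁ + d₂ + d₃
  d₂≤d = ≤-trans (m≤n+m d₂ d₁) (m≤m+n (d₁ + d₂) d₃)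
  d₃≤d : d₃ ≤ d₁ + d₂ + d₃
  d₃≤d = m≤n+m d₃ (d₁ + d₂)

  n₁≤n₀ : n₁ ≤ n₁ ⊔ n₂ ⊔ n₃
  n₁≤n₀ = ≤-trans (m≤m⊔n n₁ n₂) (m≤m⊔n (n₁ ⊔ n₂) n₃)
  n₂≤n₀ : n₂ ≤ n₁ ⊔ n₂ ⊔ n₃
  n₂≤n₀ = ≤-trans (m≤n⊔m n₁ n₂) (m≤m⊔n (n₁ ⊔ n₂) n₃)
  n₃≤n₀ : n₃ ≤ n₁ ⊔ n₂ ⊔ n₃
  n₃≤n₀ = m≤n⊔m (n₁ ⊔ n₂) n₃

  from-cover : ∀ {n m dᵢ} {g : Bits n → Bits n → Bool} → dᵢ ≤ d₁ + d₂ + d₃ →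
               (∀ k → IsC1 g k → 2 ^ n ≤ k ^ dᵢ) → Cover g (Bits m) → n ≤ (d₁ + d₂ + d₃) * m
  from-cover {m = m} {dᵢ} dᵢ≤d C¹-bound cover =
    ≤-trans (path-cover-bound {d = dᵢ} C¹-bound cover) (*-monoˡ-≤ m dᵢ≤d)

  bound : ∀ n → n₁ ⊔ n₂ ⊔ n₃ ≤ n → ∀ m → IsDCC (RelR f₁ f₂ f₃ n) m → n ≤ (d₁ + d₂ + d₃) * m
  bound n n₀≤n m ((P , P-computes , refl) , _) with ThreeCovers.some-cover f₁ f₂ f₃ n P P-computes
  ... | inj₁ cover        = from-cover d₁≤d (h₁ n (≤-trans n₁≤n₀ n₀≤n)) cover
  ... | inj₂ (inj₁ cover) = from-cover d₂≤d (h₂ n (≤-trans n₂≤n₀ n₀≤n)) cover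
  ... | inj₂ (inj₂ cover) = from-cover d₃≤d (h₃ n (≤-trans n₃≤n₀ n₀≤n)) cover
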